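{- Let $E$ be a finite set, let $X \subseteq \mathbb{R}^E$ be a non-empty convex set, and let $\mathcal{C}$ be a set of functions $X \to \mathbb{R}$ that contains a non-convex function $\tilde c\colon X \to \mathbb{R}$. Then no set $S \subseteq E$ is controlling for $(X,\mathcal{C})$.
   Context: A set $S \subseteq E$ is controlling for $(X,\mathcal{C})$ if for every $c \in \mathcal{C}$ and every $x^* \in X$ there is $\gamma \in \mathbb{R}^S$ such that the minimum $\min_{x \in X}\{c(x) + \sum_{e\in S}\gamma_e x_e\}$ exists and is attained at $x^*$. -}

module Defs where

open import Level using (Level; _⊔_) renaming (suc to lsuc)
open import Data.Nat using (ℕ; zero; suc)
open import Data.Fin using (Fin)
import Data.Fin as F
open import Data.Fin.Subset using (Subset; _∈_; _∉_)
open import Data.Product using (Σ; ∃; _×_; _,_; proj₁)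
open import Relation.Nullary using (¬_)
open import Relation.Binary.PropositionalEquality using (_≡_)
open import Relation.Binary.Structures using (IsTotalOrder)
open import Algebra.Structures using (IsCommutativeRing)

-- An ordered field whose equality is propositional equality (ℝ is one).
-- The statement is formulated for an arbitrary such field, since the
-- standard library has no real numbers.
record OrderedField (c ℓ : Level) : Set (lsuc (c ⊔ ℓ)) where
  infixl 6 _+_ _-_
  infixl 7 _*_
  infix 4 _≤_
  field
    Carrier : Set c
    _+_ _*_ : Carrier → Carrier → Carrier
    -_ : Carrier → Carrier
    0# 1# : Carrier
    isCommutativeRing : IsCommutativeRing _≡_ _+_ _*_ -_ 0# 1#
    _≤_ : Carrier → Carrier → Set ℓ
    isTotalOrder : IsTotalOrder _≡_ _≤_
    +-monoˡ-≤ : ∀ {x y} z → x ≤ y → x + z ≤ y + z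
    *-nonneg : ∀ {x y} → 0# ≤ x → 0# ≤ y → 0# ≤ x * y
    0≢1 : ¬ (0# ≡ 1#)
    inverse : ∀ x → ¬ (x ≡ 0#) → Σ Carrier (λ y → x * y ≡ 1#)

  _-_ : Carrier → Carrier → Carrier
  x - y = x + (- y)

module _ {c ℓ : Level} (R : OrderedField c ℓ) where
  open OrderedField R

  -- points of ℝ^E with E = Fin n
  Pt : ℕ → Set c
  Pt n = Fin n → Carrier

  ∑ : ∀ {n} → (Fin n → Carrier) → Carrier
  ∑ {zero}  f = 0#
  ∑ {suc n} f = f F.zero + ∑ (λ e → f (F.suc e))

  comb : ∀ {n} → Carrier → Pt n → Pt n → Pt n
  comb t x y e = t * x e + (1# - t) * y e

  ConvexSet : ∀ {n ℓX} → (Pt n → Set ℓX) → Set (c ⊔ ℓ ⊔ ℓX)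
  ConvexSet X = ∀ x y → X x → X y → ∀ t → 0# ≤ t → t ≤ 1# → X (comb t x y)

  -- functions X → ℝ : a value for each point of X, independent of the
  -- membership proof
  FunOn : ∀ {n ℓX} → (Pt n → Set ℓX) → Set (c ⊔ ℓX)
  FunOn {n} X = Σ ((x : Pt n) → X x → Carrier) (λ f → ∀ x p q → f x p ≡ f x q)

  ConvexFun : ∀ {n ℓX} {X : Pt n → Set ℓX} → ConvexSet X → FunOn X → Set (c ⊔ ℓ ⊔ ℓX)
  ConvexFun {X = X} hX (f , _) =
    ∀ x y (px : X x) (py : X y) t (t0 : 0# ≤ t) (t1 : t ≤ 1#) →
      f (comb t x y) (hX x y px py t t0 t1) ≤ t * f x px + (1# - t) * f y py

  -- S ⊆ E is controlling for (X, 𝒞): for every c ∈ 𝒞 and x* ∈ X there is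
  -- γ ∈ ℝ^S (a vector vanishing outside S) such that
  -- min_{x ∈ X} c(x) + Σ_{e∈S} γ_e x_e exists and is attained at x*.
  Controlling : ∀ {n ℓX ℓC} (X : Pt n → Set ℓX) → (FunOn X → Set ℓC) → Subset n →
                Set (c ⊔ ℓ ⊔ ℓX ⊔ ℓC)
  Controlling {n} X 𝒞 S =
    ∀ (cf : FunOn X) → 𝒞 cf → ∀ (x* : Pt n) (px* : X x*) →
      Σ (Pt n) λ γ → (∀ e → e ∉ S → γ e ≡ 0#) ×
        (∀ (x : Pt n) (px : X x) →
           proj₁ cf x* px* + ∑ (λ e → γ e * x* e) ≤ proj₁ cf x px + ∑ (λ e → γ e * x e))

{-# OPTIONS --safe #-}
-- If S were controlling, then for x, y ∈ X and z = t x + (1 - t) y some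
-- linear functional γ makes c̃ + γ minimal at z, so
--   c̃ z + γ z ≤ t (c̃ x + γ x) + (1 - t) (c̃ y + γ y).
-- By linearity the γ-terms on the right sum to γ z, which cancels and
-- leaves the convexity inequality for c̃ at (x, y, t).  Hence every member
-- of 𝒞 would be convex.
module Submission where

open import Defs
open import Level using (Level)
open import Data.Nat using (ℕ; zero; suc)
import Data.Fin as F
open import Data.Fin.Subset using (Subset)
open import Data.Product using (Σ; _,_)
open import Relation.Nullary using (¬_)
open import Relation.Binary.PropositionalEquality using (_≡_; refl; sym; cong₂; module ≡-Reasoning)
open import Algebra.Bundles using (CommutativeRing)
open import Relation.Binary.Bundles using (TotalOrder)
import Relation.Binary.Reasoning.PartialOrder as ≤-Reasoning
import Algebra.Solver.Ring.NaturalCoefficients.Default as SemiringSolver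

module _ {c ℓ : Level} (R : OrderedField c ℓ) where
  open OrderedField R

  commutativeRing : CommutativeRing c c
  commutativeRing = record { isCommutativeRing = isCommutativeRing }

  totalOrder : TotalOrder c c ℓ
  totalOrder = record { isTotalOrder = isTotalOrder }

  private
    open module CR = CommutativeRing commutativeRing
      using (+-comm; +-assoc; +-identityʳ; -‿inverseˡ; -‿inverseʳ
            ; *-identityˡ; distribʳ)
    open TotalOrder totalOrder using (≤-respˡ-≈; ≤-respʳ-≈) renaming (trans to ≤-trans)
    open import Algebra.Properties.Ring CR.ring using (x[y-z]≈xy-xz)
    open SemiringSolver CR.commutativeSemiring using (solve; _:=_; _:+_; _:*_; con)

  +-monoʳ-≤ : ∀ {x y} z → x ≤ y → z + x ≤ z + y
  +-monoʳ-≤ {x} {y} z x≤y = ≤-respˡ-≈ (+-comm x z) (≤-respʳ-≈ (+-comm y z) (+-monoˡ-≤ z x≤y))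

  +-mono-≤ : ∀ {x y u v} → x ≤ y → u ≤ v → x + u ≤ y + v
  +-mono-≤ {y = y} {u = u} x≤y u≤v = ≤-trans (+-monoˡ-≤ u x≤y) (+-monoʳ-≤ y u≤v)

  +-cancelʳ-≤ : ∀ {x y} z → x + z ≤ y + z → x ≤ y
  +-cancelʳ-≤ {x} {y} z x+z≤y+z =
    ≤-respˡ-≈ (+z-z≡id x) (≤-respʳ-≈ (+z-z≡id y) (+-monoˡ-≤ (- z) x+z≤y+z))
    where
    +z-z≡id : ∀ w → w + z + (- z) ≡ w
    +z-z≡id w = begin
      w + z + - z   ≡⟨ +-assoc w z (- z) ⟩
      w + (z + - z) ≡⟨ cong₂ _+_ refl (-‿inverseʳ z) ⟩
      w + 0#        ≡⟨ +-identityʳ w ⟩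
      w             ∎
      where open ≡-Reasoning

  x≤y⇒0≤y-x : ∀ {x y} → x ≤ y → 0# ≤ y - x
  x≤y⇒0≤y-x {x} x≤y = ≤-respˡ-≈ (-‿inverseʳ x) (+-monoˡ-≤ (- x) x≤y)

  0≤y-x⇒x≤y : ∀ {x y} → 0# ≤ y - x → x ≤ y
  0≤y-x⇒x≤y {x} {y} 0≤y-x = +-cancelʳ-≤ (- x) (≤-respˡ-≈ (sym (-‿inverseʳ x)) 0≤y-x)

  *-monoˡ-≤-nonNeg : ∀ {t x y} → 0# ≤ t → x ≤ y → t * x ≤ t * y
  *-monoˡ-≤-nonNeg {t} {x} {y} 0≤t x≤y =
    0≤y-x⇒x≤y (≤-respʳ-≈ (x[y-z]≈xy-xz t y x) (*-nonneg 0≤t (x≤y⇒0≤y-x x≤y)))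

  t+[1-t]≡1 : ∀ t → t + (1# - t) ≡ 1#
  t+[1-t]≡1 t = begin
    t + (1# - t)   ≡⟨ +-comm t (1# - t) ⟩
    1# + - t + t   ≡⟨ +-assoc 1# (- t) t ⟩
    1# + (- t + t) ≡⟨ cong₂ _+_ refl (-‿inverseˡ t) ⟩
    1# + 0#        ≡⟨ +-identityʳ 1# ⟩
    1#             ∎
    where open ≡-Reasoning

  ≤-convexCombination : ∀ {m a b} t → 0# ≤ t → t ≤ 1# → m ≤ a → m ≤ b →
                        m ≤ t * a + (1# - t) * b
  ≤-convexCombination {m} {a} {b} t 0≤t t≤1 m≤a m≤b = begin
    m                           ≡⟨ sym (*-identityˡ m) ⟩
    1# * m                      ≡⟨ cong₂ _*_ (sym (t+[1-t]≡1 t)) refl ⟩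
    (t + (1# - t)) * m          ≡⟨ distribʳ m t (1# - t) ⟩
    t * m + (1# - t) * m        ≤⟨ +-mono-≤ (*-monoˡ-≤-nonNeg 0≤t m≤a)
                                            (*-monoˡ-≤-nonNeg (x≤y⇒0≤y-x t≤1) m≤b) ⟩
    t * a + (1# - t) * b        ∎
    where open ≤-Reasoning (TotalOrder.poset totalOrder)

  infix 7 _·_

  _·_ : ∀ {n} → Pt R n → Pt R n → Carrier
  γ · x = ∑ R (λ e → γ e * x e)

  ·-linear : ∀ {n} (γ x y : Pt R n) t s →
             γ · (λ e → t * x e + s * y e) ≡ t * (γ · x) + s * (γ · y)
  ·-linear {zero}  γ x y t s = solve 2 (λ t s → con 0 := t :* con 0 :+ s :* con 0) refl t s
  ·-linear {suc n} γ x y t s = begin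
    γ₀ * (t * x₀ + s * y₀) + γ' · (λ e → t * x' e + s * y' e)
      ≡⟨ cong₂ _+_ refl (·-linear γ' x' y' t s) ⟩
    γ₀ * (t * x₀ + s * y₀) + (t * (γ' · x') + s * (γ' · y'))
      ≡⟨ solve 7 (λ γ₀ x₀ y₀ t s a b →
                   γ₀ :* (t :* x₀ :+ s :* y₀) :+ (t :* a :+ s :* b)
                := t :* (γ₀ :* x₀ :+ a) :+ s :* (γ₀ :* y₀ :+ b))
               refl γ₀ x₀ y₀ t s (γ' · x') (γ' · y') ⟩
    t * (γ₀ * x₀ + γ' · x') + s * (γ₀ * y₀ + γ' · y')
      ∎
    where
    open ≡-Reasoning
    γ₀ = γ F.zero
    x₀ = x F.zero
    y₀ = y F.zero
    γ' x' y' : Pt R n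
    γ' = λ e → γ (F.suc e)
    x' = λ e → x (F.suc e)
    y' = λ e → y (F.suc e)

  tiltedMinimum⇒convexityInequality :
    ∀ {n} (γ x y : Pt R n) t {fx fy fz} → 0# ≤ t → t ≤ 1# →
    fz + γ · comb R t x y ≤ fx + γ · x → fz + γ · comb R t x y ≤ fy + γ · y →
    fz ≤ t * fx + (1# - t) * fy
  tiltedMinimum⇒convexityInequality γ x y t {fx} {fy} {fz} 0≤t t≤1 z≤x z≤y =
    +-cancelʳ-≤ (γ · comb R t x y) (begin
      fz + γ · comb R t x y
        ≤⟨ ≤-convexCombination t 0≤t t≤1 z≤x z≤y ⟩
      t * (fx + γ · x) + (1# - t) * (fy + γ · y)
        ≡⟨ solve 6 (λ t s a b fx fy →
                     t :* (fx :+ a) :+ s :* (fy :+ b)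
                  := (t :* fx :+ s :* fy) :+ (t :* a :+ s :* b))
                 refl t (1# - t) (γ · x) (γ · y) fx fy ⟩
      (t * fx + (1# - t) * fy) + (t * (γ · x) + (1# - t) * (γ · y))
        ≡⟨ cong₂ _+_ refl (sym (·-linear γ x y t (1# - t))) ⟩
      (t * fx + (1# - t) * fy) + γ · comb R t x y
        ∎)
    where open ≤-Reasoning (TotalOrder.poset totalOrder)

  controlling⇒convex : ∀ {n ℓX ℓC} {X : Pt R n → Set ℓX} (hX : ConvexSet R X)
                       {𝒞 : FunOn R X → Set ℓC} {S : Subset n} →
                       Controlling R X 𝒞 S → ∀ {f} → 𝒞 f → ConvexFun R hX f
  controlling⇒convex hX S-controlling {f} f∈𝒞 x y px py t 0≤t t≤1 =
    let (γ , _ , minimal) = S-controlling f f∈𝒞 (comb R t x y) (hX x y px py t 0≤t t≤1)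
    in tiltedMinimum⇒convexityInequality γ x y t 0≤t t≤1 (minimal x px) (minimal y py)

lemma3p4 : ∀ {c ℓ ℓX ℓC : Level} (R : OrderedField c ℓ) (n : ℕ)
             (X : Pt R n → Set ℓX) → Σ (Pt R n) X → (hX : ConvexSet R X)
             (𝒞 : FunOn R X → Set ℓC) (c̃ : FunOn R X) → 𝒞 c̃ → ¬ ConvexFun R hX c̃ →
             ∀ (S : Subset n) → ¬ Controlling R X 𝒞 S
lemma3p4 R n X _ hX 𝒞 c̃ c̃∈𝒞 c̃-nonconvex S S-controlling =
  c̃-nonconvex (controlling⇒convex R hX S-controlling c̃∈𝒞)
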